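{- Let $K$ be a field of characteristic not equal to $2$, let $f(z)=z^2+c\in K[z]$, and let $r>s\ge2$ be minimal such that $f^r(0)=-f^s(0)$. Let $x\in\overline K$ and let $\pm y$ be its two preimages under $f$. Let $\pm\alpha_1,\dots,\pm\alpha_{2^{r-1}}$ be the roots of $f^r(z)=y$ and $\pm\beta_1,\dots,\pm\beta_{2^{s-1}}$ the roots of $f^s(z)=-y$ (listed with multiplicity). Suppose $f^s(0)\ne-y$, and define $\gamma=\dfrac{\alpha_1\cdots\alpha_{2^{r-1}}}{\beta_1\cdots\beta_{2^{s-1}}}$. Then $\gamma^2=-1$.
   Context: $f^n$ denotes the $n$-th iterate of $f$. -}

module Defs where

open import Level using (Level; _⊔_)
open import Data.Nat using (ℕ; zero; suc)
open import Data.List using (List; []; _∷_; map)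
open import Data.Product using (_×_; ∃)
open import Data.Unit.Polymorphic using (⊤)
open import Data.Empty.Polymorphic using (⊥)
open import Relation.Nullary using (¬_)
open import Algebra.Bundles using (CommutativeRing)
open import Algebra.Morphism.Structures using (IsRingHomomorphism)

iter : ∀ {a} {A : Set a} → (A → A) → ℕ → A → A
iter f zero    x = x
iter f (suc n) x = f (iter f n x)

IsField : ∀ {c ℓ} → CommutativeRing c ℓ → Set (c ⊔ ℓ)
IsField R = (¬ (1# ≈ 0#)) × (∀ a → ¬ (a ≈ 0#) → ∃ λ b → a * b ≈ 1#)
  where open CommutativeRing R

CharNot2 : ∀ {c ℓ} → CommutativeRing c ℓ → Set ℓ
CharNot2 R = ¬ ((1# + 1#) ≈ 0#)
  where open CommutativeRing R

-- Polynomials in one variable over a commutative ring R,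
-- as lists of coefficients (constant term first).
module Poly {c ℓ} (R : CommutativeRing c ℓ) where
  open CommutativeRing R

  Pol : Set c
  Pol = List Carrier

  infixl 6 _+P_
  infixl 7 _*P_
  infix 4 _≈P_

  _+P_ : Pol → Pol → Pol
  [] +P q = q
  (a ∷ p) +P [] = a ∷ p
  (a ∷ p) +P (b ∷ q) = (a + b) ∷ (p +P q)

  scaleP : Carrier → Pol → Pol
  scaleP a p = map (a *_) p

  _*P_ : Pol → Pol → Pol
  [] *P q = []
  (a ∷ p) *P q = scaleP a q +P (0# ∷ (p *P q))

  constP : Carrier → Pol
  constP a = a ∷ []

  X : Pol
  X = 0# ∷ 1# ∷ []

  prodP : List Pol → Pol
  prodP [] = constP 1#
  prodP (p ∷ ps) = p *P prodP ps

  -- equality of polynomials (coefficientwise, trailing zeros ignored)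
  _≈P_ : Pol → Pol → Set ℓ
  [] ≈P [] = ⊤
  [] ≈P (b ∷ q) = (b ≈ 0#) × ([] ≈P q)
  (a ∷ p) ≈P [] = (a ≈ 0#) × (p ≈P [])
  (a ∷ p) ≈P (b ∷ q) = (a ≈ b) × (p ≈P q)

  eval : Pol → Carrier → Carrier
  eval [] z = 0#
  eval (a ∷ p) z = a + z * eval p z

  NonConstant : Pol → Set ℓ
  NonConstant [] = ⊥
  NonConstant (a ∷ p) = ¬ (p ≈P [])

  AlgClosed : Set (c ⊔ ℓ)
  AlgClosed = ∀ (p : Pol) → NonConstant p → ∃ λ z → eval p z ≈ 0#

IsAlgebraicClosure : ∀ {c ℓ c' ℓ'} (K : CommutativeRing c ℓ) (L : CommutativeRing c' ℓ') →
                     (CommutativeRing.Carrier K → CommutativeRing.Carrier L) → Set (c ⊔ ℓ ⊔ c' ⊔ ℓ')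
IsAlgebraicClosure K L φ =
  IsField L × Poly.AlgClosed L ×
  IsRingHomomorphism (CommutativeRing.rawRing K) (CommutativeRing.rawRing L) φ ×
  (∀ z → ∃ λ (p : Poly.Pol K) → (¬ Poly._≈P_ K p []) ×
         CommutativeRing._≈_ L (Poly.eval L (map φ p) z) (CommutativeRing.0# L))

module Quad {c ℓ} (R : CommutativeRing c ℓ) where
  open CommutativeRing R
  open Poly R

  quad : Carrier → Carrier → Carrier
  quad cc z = z * z + cc

  quadIterP : Carrier → ℕ → Pol
  quadIterP cc n = iter (λ p → p *P p +P constP cc) n X

  pmPair : Carrier → Pol
  pmPair a = (X +P constP (- a)) *P (X +P constP a)

{-# OPTIONS --safe #-}
module Submission where

open import Defs
open import Level using (Level)
open import Data.Nat as ℕ using (ℕ; zero; suc; _≤_; _<_; _∸_; _^_; s≤s)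
import Data.Nat.Properties as ℕ
open import Data.Vec using (Vec; []; _∷_; toList; foldr)
open import Data.List using ([]; _∷_; map)
open import Data.Product using (_×_; _,_; proj₂; ∃)
open import Relation.Binary.PropositionalEquality using (_≡_)
open import Relation.Nullary using (¬_)
open import Algebra.Bundles using (CommutativeRing)
open import Algebra.Morphism.Structures using (IsRingHomomorphism)
import Algebra.Properties.Ring as RingProperties
import Algebra.Properties.CommutativeSemigroup as CommutativeSemigroupProperties
import Relation.Binary.Reasoning.Setoid as SetoidReasoning

-- Compare constant coefficients. Since r, s ≥ 2, the factorisations of
-- f^r(z) - y and f^s(z) + y have an even number of factors (z - a)(z + a), so their
-- constant terms are squares: f^r(0) - y = A² and f^s(0) + y = B², where A and B are
-- the products of the αᵢ and of the βⱼ. As f^r(0) = -f^s(0), this gives A² = -B², and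
-- B² ≠ 0 because f^s(0) ≠ -y; cancelling B² in (γB)² = A² = -B² yields γ² = -1.

module _ {c ℓ} (R : CommutativeRing c ℓ) where
  open CommutativeRing R
  open Poly R
  open Quad R
  open RingProperties ring using (-‿distribˡ-*; -‿involutive; -1*x≈-x)
  open CommutativeSemigroupProperties *-commutativeSemigroup using (interchange; x∙yz≈y∙xz)
  open SetoidReasoning setoid

  constCoeff : Pol → Carrier
  constCoeff []      = 0#
  constCoeff (a ∷ _) = a

  constCoeff-cong : ∀ p q → p ≈P q → constCoeff p ≈ constCoeff q
  constCoeff-cong []      []      _         = refl
  constCoeff-cong []      (b ∷ q) (b≈0 , _) = sym b≈0
  constCoeff-cong (a ∷ p) []      (a≈0 , _) = a≈0
  constCoeff-cong (a ∷ p) (b ∷ q) (a≈b , _) = a≈b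

  constCoeff-+P : ∀ p q → constCoeff (p +P q) ≈ constCoeff p + constCoeff q
  constCoeff-+P []      q       = sym (+-identityˡ _)
  constCoeff-+P (a ∷ p) []      = sym (+-identityʳ a)
  constCoeff-+P (a ∷ p) (b ∷ q) = refl

  constCoeff-scaleP : ∀ a q → constCoeff (scaleP a q) ≈ a * constCoeff q
  constCoeff-scaleP a []      = sym (zeroʳ a)
  constCoeff-scaleP a (b ∷ q) = refl

  constCoeff-*P : ∀ p q → constCoeff (p *P q) ≈ constCoeff p * constCoeff q
  constCoeff-*P []      q = sym (zeroˡ _)
  constCoeff-*P (a ∷ p) q = begin
    constCoeff (scaleP a q +P (0# ∷ p *P q)) ≈⟨ constCoeff-+P (scaleP a q) (0# ∷ p *P q) ⟩
    constCoeff (scaleP a q) + 0#             ≈⟨ +-identityʳ _ ⟩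
    constCoeff (scaleP a q)                  ≈⟨ constCoeff-scaleP a q ⟩
    a * constCoeff q                         ∎

  constCoeff-quadIterP : ∀ cc n → constCoeff (quadIterP cc n) ≈ iter (quad cc) n 0#
  constCoeff-quadIterP cc zero    = refl
  constCoeff-quadIterP cc (suc n) = begin
    constCoeff (p *P p +P constP cc)       ≈⟨ constCoeff-+P (p *P p) (constP cc) ⟩
    constCoeff (p *P p) + cc               ≈⟨ +-congʳ (constCoeff-*P p p) ⟩
    constCoeff p * constCoeff p + cc       ≈⟨ +-congʳ (*-cong IH IH) ⟩
    quad cc (iter (quad cc) n 0#)          ∎
    where
    p : Pol
    p = quadIterP cc n
    IH : constCoeff p ≈ iter (quad cc) n 0#
    IH = constCoeff-quadIterP cc n

  constCoeff-pmPair : ∀ a → constCoeff (pmPair a) ≈ - (a * a)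
  constCoeff-pmPair a = begin
    constCoeff (pmPair a)            ≈⟨ constCoeff-*P (X +P constP (- a)) (X +P constP a) ⟩
    (0# + - a) * (0# + a)            ≈⟨ *-cong (+-identityˡ _) (+-identityˡ _) ⟩
    - a * a                          ≈⟨ -‿distribˡ-* a a ⟨
    - (a * a)                        ∎

  sign : ℕ → Carrier
  sign zero    = 1#
  sign (suc n) = - sign n

  sign-+-self : ∀ n → sign (n ℕ.+ n) ≈ 1#
  sign-+-self zero    = refl
  sign-+-self (suc n) rewrite ℕ.+-suc n n = trans (-‿involutive _) (sign-+-self n)

  sign-2^suc : ∀ k → sign (2 ^ suc k) ≈ 1#
  sign-2^suc k rewrite ℕ.+-identityʳ (2 ^ k) = sign-+-self (2 ^ k)

  product : ∀ {n} → Vec Carrier n → Carrier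
  product = foldr _ _*_ 1#

  constCoeff-prodP-pmPair : ∀ {n} (v : Vec Carrier n) →
    constCoeff (prodP (map pmPair (toList v))) ≈ sign n * (product v * product v)
  constCoeff-prodP-pmPair []               = sym (trans (*-identityˡ _) (*-identityˡ 1#))
  constCoeff-prodP-pmPair {suc n} (a ∷ v) = begin
    constCoeff (pmPair a *P ps)                ≈⟨ constCoeff-*P (pmPair a) ps ⟩
    constCoeff (pmPair a) * constCoeff ps      ≈⟨ *-cong (constCoeff-pmPair a) (constCoeff-prodP-pmPair v) ⟩
    - (a * a) * (sign n * (P * P))             ≈⟨ -‿distribˡ-* _ _ ⟨
    - (a * a * (sign n * (P * P)))             ≈⟨ -‿cong (x∙yz≈y∙xz (a * a) (sign n) (P * P)) ⟩
    - (sign n * (a * a * (P * P)))             ≈⟨ -‿cong (*-congˡ (interchange a a P P)) ⟩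
    - (sign n * (a * P * (a * P)))             ≈⟨ -‿distribˡ-* _ _ ⟩
    - sign n * (a * P * (a * P))               ∎
    where
    ps : Pol
    ps = prodP (map pmPair (toList v))
    P : Carrier
    P = product v

  quad-orbit+e≈product² : ∀ cc n e k (v : Vec Carrier (2 ^ suc k)) →
    quadIterP cc n +P constP e ≈P prodP (map pmPair (toList v)) →
    iter (quad cc) n 0# + e ≈ product v * product v
  quad-orbit+e≈product² cc n e k v factorisation = begin
    iter (quad cc) n 0# + e                            ≈⟨ +-congʳ (constCoeff-quadIterP cc n) ⟨
    constCoeff (quadIterP cc n) + e                    ≈⟨ constCoeff-+P (quadIterP cc n) (constP e) ⟨
    constCoeff (quadIterP cc n +P constP e)            ≈⟨ constCoeff-cong _ _ factorisation ⟩
    constCoeff (prodP (map pmPair (toList v)))         ≈⟨ constCoeff-prodP-pmPair v ⟩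
    sign (2 ^ suc k) * (product v * product v)         ≈⟨ *-congʳ (sign-2^suc k) ⟩
    1# * (product v * product v)                       ≈⟨ *-identityˡ _ ⟩
    product v * product v                              ∎

  *-cancelʳ-invertible : ∀ {b b⁻¹ x y} → b * b⁻¹ ≈ 1# → x * b ≈ y * b → x ≈ y
  *-cancelʳ-invertible {b} {b⁻¹} {x} {y} bb⁻¹≈1 xb≈yb = begin
    x              ≈⟨ *-identityʳ x ⟨
    x * 1#         ≈⟨ *-congˡ bb⁻¹≈1 ⟨
    x * (b * b⁻¹)  ≈⟨ *-assoc x b b⁻¹ ⟨
    x * b * b⁻¹    ≈⟨ *-congʳ xb≈yb ⟩
    y * b * b⁻¹    ≈⟨ *-assoc y b b⁻¹ ⟩
    y * (b * b⁻¹)  ≈⟨ *-congˡ bb⁻¹≈1 ⟩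
    y * 1#         ≈⟨ *-identityʳ y ⟩
    y              ∎

  ratio²≈-1 : ∀ {a b b²⁻¹ γ} → b * b * b²⁻¹ ≈ 1# → a * a ≈ - (b * b) → γ * b ≈ a → γ * γ ≈ - 1#
  ratio²≈-1 {a} {b} {_} {γ} b²-inverse a²≈-b² γb≈a = *-cancelʳ-invertible b²-inverse (begin
    γ * γ * (b * b)  ≈⟨ interchange γ γ b b ⟩
    γ * b * (γ * b)  ≈⟨ *-cong γb≈a γb≈a ⟩
    a * a            ≈⟨ a²≈-b² ⟩
    - (b * b)        ≈⟨ -1*x≈-x (b * b) ⟨
    - 1# * (b * b)   ∎)

module _ {c ℓ c' ℓ'} (K : CommutativeRing c ℓ) (L : CommutativeRing c' ℓ')
         {φ : CommutativeRing.Carrier K → CommutativeRing.Carrier L}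
         (φ-homo : IsRingHomomorphism (CommutativeRing.rawRing K) (CommutativeRing.rawRing L) φ)
         where
  private module K = CommutativeRing K
  open CommutativeRing L
  open IsRingHomomorphism φ-homo
  open SetoidReasoning setoid

  iter-quad-homo : ∀ cc n {z z'} → φ z ≈ z' →
    φ (iter (Quad.quad K cc) n z) ≈ iter (Quad.quad L (φ cc)) n z'
  iter-quad-homo cc zero    φz≈z' = φz≈z'
  iter-quad-homo cc (suc n) {z} {z'} φz≈z' = begin
    φ (w K.* w K.+ cc)   ≈⟨ +-homo (w K.* w) cc ⟩
    φ (w K.* w) + φ cc   ≈⟨ +-congʳ (*-homo w w) ⟩
    φ w * φ w + φ cc     ≈⟨ +-congʳ (*-cong IH IH) ⟩
    Quad.quad L (φ cc) (iter (Quad.quad L (φ cc)) n z') ∎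
    where
    w : K.Carrier
    w = iter (Quad.quad K cc) n z
    IH : φ w ≈ iter (Quad.quad L (φ cc)) n z'
    IH = iter-quad-homo cc n φz≈z'

  quad-orbits-antipodal-homo : ∀ cc m n →
    iter (Quad.quad K cc) m K.0# K.≈ K.- iter (Quad.quad K cc) n K.0# →
    iter (Quad.quad L (φ cc)) m 0# ≈ - iter (Quad.quad L (φ cc)) n 0#
  quad-orbits-antipodal-homo cc m n antipodal = begin
    iter (Quad.quad L (φ cc)) m 0#     ≈⟨ iter-quad-homo cc m 0#-homo ⟨
    φ (iter (Quad.quad K cc) m K.0#)   ≈⟨ ⟦⟧-cong antipodal ⟩
    φ (K.- iter (Quad.quad K cc) n K.0#) ≈⟨ -‿homo _ ⟩
    - φ (iter (Quad.quad K cc) n K.0#) ≈⟨ -‿cong (iter-quad-homo cc n 0#-homo) ⟩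
    - iter (Quad.quad L (φ cc)) n 0#   ∎

lemma3p1 : ∀ {c ℓ c' ℓ' : Level}
  (K : CommutativeRing c ℓ) → IsField K → CharNot2 K →
  (L : CommutativeRing c' ℓ') (φ : CommutativeRing.Carrier K → CommutativeRing.Carrier L) →
  IsAlgebraicClosure K L φ →
  (cK : CommutativeRing.Carrier K) (r s : ℕ) →
  2 ≤ s → s < r →
  CommutativeRing._≈_ K (iter (Quad.quad K cK) r (CommutativeRing.0# K))
                        (CommutativeRing.-_ K (iter (Quad.quad K cK) s (CommutativeRing.0# K))) →
  (∀ r' s' → 2 ≤ s' → s' < r' →
    CommutativeRing._≈_ K (iter (Quad.quad K cK) r' (CommutativeRing.0# K))
                          (CommutativeRing.-_ K (iter (Quad.quad K cK) s' (CommutativeRing.0# K))) →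
    r ≤ r' × (r' ≡ r → s ≤ s')) →
  let open CommutativeRing L in
  let open Poly L in
  let open Quad L in
  (x y : Carrier) → quad (φ cK) y ≈ x →
  (αs : Vec Carrier (2 ^ (r ∸ 1))) (βs : Vec Carrier (2 ^ (s ∸ 1))) →
  (quadIterP (φ cK) r +P constP (- y)) ≈P prodP (map pmPair (toList αs)) →
  (quadIterP (φ cK) s +P constP y) ≈P prodP (map pmPair (toList βs)) →
  ¬ (iter (quad (φ cK)) s 0# ≈ (- y)) →
  (γ : Carrier) → γ * foldr _ _*_ 1# βs ≈ foldr _ _*_ 1# αs →
  γ * γ ≈ - 1#
lemma3p1 K _ _ L φ (L-isField , _ , φ-homo , _) cK r@(suc (suc r-2)) s@(suc (suc s-2)) (s≤s (s≤s _)) (s≤s (s≤s _))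
         orbits-antipodal _ _ y _ αs βs factorisation-α factorisation-β orbit-s≉-y γ γB≈A =
  ratio²≈-1 L (proj₂ B²-inverse) A²≈-B² γB≈A
  where
  open CommutativeRing L
  open Quad L
  open RingProperties ring using (-‿+-comm; +-inverseˡ-unique)
  open SetoidReasoning setoid

  orbit : ℕ → Carrier
  orbit n = iter (quad (φ cK)) n 0#

  A B : Carrier
  A = product L αs
  B = product L βs

  orbit-r-y≈A² : orbit r + - y ≈ A * A
  orbit-r-y≈A² = quad-orbit+e≈product² L (φ cK) r (- y) r-2 αs factorisation-α

  orbit-s+y≈B² : orbit s + y ≈ B * B
  orbit-s+y≈B² = quad-orbit+e≈product² L (φ cK) s y s-2 βs factorisation-β

  A²≈-B² : A * A ≈ - (B * B)
  A²≈-B² = begin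
    A * A            ≈⟨ orbit-r-y≈A² ⟨
    orbit r + - y    ≈⟨ +-congʳ (quad-orbits-antipodal-homo K L φ-homo cK r s orbits-antipodal) ⟩
    - orbit s + - y  ≈⟨ -‿+-comm _ y ⟩
    - (orbit s + y)  ≈⟨ -‿cong orbit-s+y≈B² ⟩
    - (B * B)        ∎

  B²≉0 : ¬ B * B ≈ 0#
  B²≉0 B²≈0 = orbit-s≉-y (+-inverseˡ-unique _ y (trans orbit-s+y≈B² B²≈0))

  B²-inverse : ∃ λ b²⁻¹ → B * B * b²⁻¹ ≈ 1#
  B²-inverse = proj₂ L-isField (B * B) B²≉0
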